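{- Given two session types $S, S'$, it is decidable whether $S \dashv S'$. Moreover, if $S \dashv S'$, then an orchestrator $\mathsf f$ such that $\mathsf f : S \dashv S'$ is computable.
   Context: Ground types $G$ are, e.g., $\mathtt{Nat}, \mathtt{Bool}, \ldots$. Labels range over a countable set $\mathcal L$ and polarities are $p\in\{+,-\}$. Session types are the finite terms $$S ::= \mathsf{end} \mid ?G.S \mid !G.S \mid ?(S_1^p).S_2 \mid !(S_1^p).S_2 \mid \oplus\{l_i{:}S_i\}_{i\in I} \mid \&\{l_i{:}S_i\}_{i\in I} \mid \langle\!\langle l_i{:}S_i\rangle\!\rangle_{i\in I}.$$ These constructors are, in order: terminated, value input, value output, session (channel) input, session output, selection, branching, and speculative selection. In the last three, $I$ is finite and nonempty and the labels are pairwise distinct. Orchestrators are the terms $$\mathsf f,\mathsf g ::= \mathfrak 1 \mid \bullet.\mathsf f \mid l.\mathsf f \mid l.\mathsf f + l'.\mathsf g \mid l.\mathsf f\oplus l'.\mathsf g \qquad (l\neq l').$$ We write $\sum_{i\in I} l_i.\mathsf f_i$ and $\bigoplus_{i\in I} l_i.\mathsf f_i$ for $n$-ary external and internal choices, where $I$ is nonempty and the labels are pairwise distinct; when $I$ is a singleton either form is just the prefix $l.\mathsf f$. Orchestrated compliance $\mathsf f : S\dashv S'$ is the least relation such that: (1) $\mathfrak 1 : \mathsf{end}\dashv S$ for every $S$; (2) if $\mathsf f: S\dashv S'$ then $\bullet.\mathsf f : ?G.S \dashv !G.S'$ and $\bullet.\mathsf f : !G.S\dashv ?G.S'$ for every $G$;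 (2') if $\mathsf f : S_2\dashv S_2'$ then $\bullet.\mathsf f : ?(S_1^p).S_2 \dashv !(S_1^p).S_2'$ and $\bullet.\mathsf f : !(S_1^p).S_2\dashv ?(S_1^p).S_2'$; (3) if $\mathsf f_i : S_i\dashv S_i'$ for all $i\in I$, then for any index set $J$: $\sum_{i\in I} l_i.\mathsf f_i : \oplus\{l_i{:}S_i\}_{i\in I}\dashv \&\{l_j{:}S'_j\}_{j\in I\cup J}$ and $\sum_{i\in I} l_i.\mathsf f_i : \&\{l_j{:}S_j\}_{j\in I\cup J}\dashv \oplus\{l_i{:}S'_i\}_{i\in I}$; (4) if $\emptyset\neq H\subseteq I\cap J$ and $\mathsf f_h : S_h\dashv S'_h$ for all $h\in H$, then $\bigoplus_{h\in H} l_h.\mathsf f_h : \langle\!\langle l_i{:}S_i\rangle\!\rangle_{i\in I}\dashv \&\{l_j{:}S'_j\}_{j\in J}$ and $\bigoplus_{h\in H} l_h.\mathsf f_h : \&\{l_j{:}S_j\}_{j\in J}\dashv \langle\!\langle l_i{:}S'_i\rangle\!\rangle_{i\in I}$. We write $S\dashv S'$ if $\mathsf f : S\dashv S'$ for some orchestrator $\mathsf f$. -}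

module Defs where

open import Data.Nat using (ℕ)
open import Data.Product using (Σ; ∃; _×_; _,_; proj₁; proj₂)
open import Data.List using (List; []; _∷_; map)
open import Data.List.NonEmpty using (List⁺; _∷_; toList)
open import Data.List.Relation.Unary.All using (All)
open import Data.List.Relation.Unary.Unique.Propositional using (Unique)
open import Data.List.Membership.Propositional using (_∈_)

Label : Set
Label = ℕ

data Pol : Set where
  pos neg : Pol

-- Raw session types over a set G of ground types.
-- Branching constructs carry a nonempty finite list of labelled branches;
-- distinctness of labels is imposed by the well-formedness predicate WF.
data SType (G : Set) : Set where
  end   : SType G
  inV   : G → SType G → SType G
  outV  : G → SType G → SType G
  inS   : SType G → Pol → SType G → SType G
  outS  : SType G → Pol → SType G → SType G
  sel   : List⁺ (Label × SType G) → SType G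
  bra   : List⁺ (Label × SType G) → SType G
  spec  : List⁺ (Label × SType G) → SType G

labels : {A : Set} → List⁺ (Label × A) → List Label
labels xs = map proj₁ (toList xs)

data WF {G : Set} : SType G → Set where
  wf-end  : WF end
  wf-inV  : ∀ {g S} → WF S → WF (inV g S)
  wf-outV : ∀ {g S} → WF S → WF (outV g S)
  wf-inS  : ∀ {S₁ p S₂} → WF S₁ → WF S₂ → WF (inS S₁ p S₂)
  wf-outS : ∀ {S₁ p S₂} → WF S₁ → WF S₂ → WF (outS S₁ p S₂)
  wf-sel  : ∀ {bs} → Unique (labels bs) → All (λ b → WF (proj₂ b)) (toList bs) → WF (sel bs)
  wf-bra  : ∀ {bs} → Unique (labels bs) → All (λ b → WF (proj₂ b)) (toList bs) → WF (bra bs)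
  wf-spec : ∀ {bs} → Unique (labels bs) → All (λ b → WF (proj₂ b)) (toList bs) → WF (spec bs)

-- Orchestrators. n-ary choices with at least two summands are primitive;
-- a singleton choice is the prefix l.f (see Σₒ and ⨁ₒ below).
data Orch : Set where
  𝟙    : Orch
  •_   : Orch → Orch
  pre  : Label → Orch → Orch
  ext  : Label × Orch → Label × Orch → List (Label × Orch) → Orch
  int  : Label × Orch → Label × Orch → List (Label × Orch) → Orch

Σₒ : List⁺ (Label × Orch) → Orch
Σₒ ((l , f) ∷ [])     = pre l f
Σₒ (x ∷ (y ∷ rest))   = ext x y rest

⨁ₒ : List⁺ (Label × Orch) → Orch
⨁ₒ ((l , f) ∷ [])     = pre l f
⨁ₒ (x ∷ (y ∷ rest))   = int x y rest

-- In the choice rules, the orchestrator's summands are a list os with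
-- distinct labels; each summand (l , f) is matched with the branches with
-- label l on both sides, and f must orchestrate those continuations.
data _∶_⊣_ {G : Set} : Orch → SType G → SType G → Set where
  c-end   : ∀ {S} → 𝟙 ∶ end ⊣ S
  c-inV   : ∀ {f g S S'} → f ∶ S ⊣ S' → (• f) ∶ inV g S ⊣ outV g S'
  c-outV  : ∀ {f g S S'} → f ∶ S ⊣ S' → (• f) ∶ outV g S ⊣ inV g S'
  c-inS   : ∀ {f S₁ p S₂ S₂'} → f ∶ S₂ ⊣ S₂' → (• f) ∶ inS S₁ p S₂ ⊣ outS S₁ p S₂'
  c-outS  : ∀ {f S₁ p S₂ S₂'} → f ∶ S₂ ⊣ S₂' → (• f) ∶ outS S₁ p S₂ ⊣ inS S₁ p S₂'
  -- rule (3), first form:  Σ l_i.f_i : ⊕{l_i:S_i}_{i∈I} ⊣ &{l_j:S'_j}_{j∈I∪J}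
  c-sel-bra : ∀ {bs cs} (os : List⁺ (Label × Orch)) →
    Unique (labels os) →
    (∀ {l S} → (l , S) ∈ toList bs → l ∈ labels os) →
    All (λ o → Σ (SType G) λ S → Σ (SType G) λ S' →
           ((proj₁ o , S) ∈ toList bs) × ((proj₁ o , S') ∈ toList cs) × (proj₂ o ∶ S ⊣ S'))
        (toList os) →
    Σₒ os ∶ sel bs ⊣ bra cs
  -- rule (3), second form:  Σ l_i.f_i : &{l_j:S_j}_{j∈I∪J} ⊣ ⊕{l_i:S'_i}_{i∈I}
  c-bra-sel : ∀ {cs bs} (os : List⁺ (Label × Orch)) →
    Unique (labels os) →
    (∀ {l S'} → (l , S') ∈ toList bs → l ∈ labels os) →
    All (λ o → Σ (SType G) λ S → Σ (SType G) λ S' →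
           ((proj₁ o , S) ∈ toList cs) × ((proj₁ o , S') ∈ toList bs) × (proj₂ o ∶ S ⊣ S'))
        (toList os) →
    Σₒ os ∶ bra cs ⊣ sel bs
  -- rule (4), first form:  ⨁_{h∈H} l_h.f_h : ⟨⟨l_i:S_i⟩⟩_{i∈I} ⊣ &{l_j:S'_j}_{j∈J},  ∅≠H⊆I∩J
  c-spec-bra : ∀ {is js} (os : List⁺ (Label × Orch)) →
    Unique (labels os) →
    All (λ o → Σ (SType G) λ S → Σ (SType G) λ S' →
           ((proj₁ o , S) ∈ toList is) × ((proj₁ o , S') ∈ toList js) × (proj₂ o ∶ S ⊣ S'))
        (toList os) →
    ⨁ₒ os ∶ spec is ⊣ bra js
  -- rule (4), second form:  ⨁_{h∈H} l_h.f_h : &{l_j:S_j}_{j∈J} ⊣ ⟨⟨l_i:S'_i⟩⟩_{i∈I}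
  c-bra-spec : ∀ {js is} (os : List⁺ (Label × Orch)) →
    Unique (labels os) →
    All (λ o → Σ (SType G) λ S → Σ (SType G) λ S' →
           ((proj₁ o , S) ∈ toList js) × ((proj₁ o , S') ∈ toList is) × (proj₂ o ∶ S ⊣ S'))
        (toList os) →
    ⨁ₒ os ∶ bra js ⊣ spec is

_⊣_ : {G : Set} → SType G → SType G → Set
S ⊣ S' = ∃ λ f → f ∶ S ⊣ S'

-- Compliance is syntax directed: the pair of head constructors fixes the only
-- rule that can apply, and every premise is about strict subterms of the left
-- type. The prefix rules reduce to equality of the exchanged payloads plus
-- compliance of the continuations. A choice rule reduces to a finite question
-- per label l: do the l-branches on the two sides contain a compliant pair?
-- Rule (3) needs this for every label of the selection, rule (4) for some
-- label of the speculative selection; conversely such pairs, one per label,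
-- are exactly the summands of an orchestrator. Distinct labels in the
-- selection make the summands of (3) distinct and pin down the branch each
-- one talks about. The decision is constructive, so a positive answer comes
-- with its orchestrator.
module Submission where

open import Defs
open import Data.Nat using (_≟_)
open import Data.Product using (Σ; Σ-syntax; ∃-syntax; _×_; _,_; proj₁; proj₂)
open import Data.Sum using (inj₁; inj₂)
open import Data.List using (List; []; _∷_; map)
open import Data.List.NonEmpty using (List⁺; _∷_; toList)
open import Data.List.Relation.Unary.All as All using (All; []; _∷_; all?)
open import Data.List.Relation.Unary.Any using (Any; here; there; any?; satisfied)
open import Data.List.Relation.Unary.AllPairs using ([]; _∷_)
open import Data.List.Relation.Unary.Unique.Propositional using (Unique)
open import Data.List.Membership.Propositional using (_∈_; lose)
open import Data.List.Membership.Propositional.Properties using (∈-map⁺; ∈-map⁻)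
open import Function using (_∘′_)
open import Function.Bundles using (_⇔_; mk⇔)
open import Relation.Binary.Definitions using (DecidableEquality)
open import Relation.Binary.PropositionalEquality using (_≡_; refl; sym; cong; subst)
open import Relation.Nullary using (Dec; yes; no)
open import Relation.Nullary.Decidable as Dec using (map′; _×-dec_; _⊎-dec_)

_≟-Pol_ : DecidableEquality Pol
pos ≟-Pol pos = yes refl
neg ≟-Pol neg = yes refl
pos ≟-Pol neg = no λ ()
neg ≟-Pol pos = no λ ()

module STypeEquality {G : Set} (_≟G_ : DecidableEquality G) where

  infix 4 _≟-SType_ _≟-Branch_ _≟-Branches_ _≟-Branches⁺_

  _≟-SType_     : DecidableEquality (SType G)
  _≟-Branch_    : DecidableEquality (Label × SType G)
  _≟-Branches_  : DecidableEquality (List (Label × SType G))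
  _≟-Branches⁺_ : DecidableEquality (List⁺ (Label × SType G))

  (l , S) ≟-Branch (k , T) =
    map′ (λ { (refl , refl) → refl }) (λ { refl → refl , refl }) (l ≟ k ×-dec S ≟-SType T)

  []       ≟-Branches []       = yes refl
  (b ∷ bs) ≟-Branches (c ∷ cs) =
    map′ (λ { (refl , refl) → refl }) (λ { refl → refl , refl }) (b ≟-Branch c ×-dec bs ≟-Branches cs)
  []       ≟-Branches (_ ∷ _)  = no λ ()
  (_ ∷ _)  ≟-Branches []       = no λ ()

  (b ∷ bs) ≟-Branches⁺ (c ∷ cs) =
    map′ (λ { (refl , refl) → refl }) (λ { refl → refl , refl }) (b ≟-Branch c ×-dec bs ≟-Branches cs)

  end           ≟-SType end           = yes refl
  inV g S       ≟-SType inV h T       =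
    map′ (λ { (refl , refl) → refl }) (λ { refl → refl , refl }) (g ≟G h ×-dec S ≟-SType T)
  outV g S      ≟-SType outV h T      =
    map′ (λ { (refl , refl) → refl }) (λ { refl → refl , refl }) (g ≟G h ×-dec S ≟-SType T)
  inS S₁ p S₂   ≟-SType inS T₁ q T₂   =
    map′ (λ { (refl , refl , refl) → refl }) (λ { refl → refl , refl , refl })
         (S₁ ≟-SType T₁ ×-dec p ≟-Pol q ×-dec S₂ ≟-SType T₂)
  outS S₁ p S₂  ≟-SType outS T₁ q T₂  =
    map′ (λ { (refl , refl , refl) → refl }) (λ { refl → refl , refl , refl })
         (S₁ ≟-SType T₁ ×-dec p ≟-Pol q ×-dec S₂ ≟-SType T₂)
  sel bs        ≟-SType sel cs        = map′ (cong sel) (λ { refl → refl }) (bs ≟-Branches⁺ cs)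
  bra bs        ≟-SType bra cs        = map′ (cong bra) (λ { refl → refl }) (bs ≟-Branches⁺ cs)
  spec bs       ≟-SType spec cs       = map′ (cong spec) (λ { refl → refl }) (bs ≟-Branches⁺ cs)
  end           ≟-SType inV _ _       = no λ ()
  end           ≟-SType outV _ _      = no λ ()
  end           ≟-SType inS _ _ _     = no λ ()
  end           ≟-SType outS _ _ _    = no λ ()
  end           ≟-SType sel _         = no λ ()
  end           ≟-SType bra _         = no λ ()
  end           ≟-SType spec _        = no λ ()
  inV _ _       ≟-SType end           = no λ ()
  inV _ _       ≟-SType outV _ _      = no λ ()
  inV _ _       ≟-SType inS _ _ _     = no λ ()
  inV _ _       ≟-SType outS _ _ _    = no λ ()
  inV _ _       ≟-SType sel _         = no λ ()
  inV _ _       ≟-SType bra _         = no λ ()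
  inV _ _       ≟-SType spec _        = no λ ()
  outV _ _      ≟-SType end           = no λ ()
  outV _ _      ≟-SType inV _ _       = no λ ()
  outV _ _      ≟-SType inS _ _ _     = no λ ()
  outV _ _      ≟-SType outS _ _ _    = no λ ()
  outV _ _      ≟-SType sel _         = no λ ()
  outV _ _      ≟-SType bra _         = no λ ()
  outV _ _      ≟-SType spec _        = no λ ()
  inS _ _ _     ≟-SType end           = no λ ()
  inS _ _ _     ≟-SType inV _ _       = no λ ()
  inS _ _ _     ≟-SType outV _ _      = no λ ()
  inS _ _ _     ≟-SType outS _ _ _    = no λ ()
  inS _ _ _     ≟-SType sel _         = no λ ()
  inS _ _ _     ≟-SType bra _         = no λ ()
  inS _ _ _     ≟-SType spec _        = no λ ()
  outS _ _ _    ≟-SType end           = no λ ()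
  outS _ _ _    ≟-SType inV _ _       = no λ ()
  outS _ _ _    ≟-SType outV _ _      = no λ ()
  outS _ _ _    ≟-SType inS _ _ _     = no λ ()
  outS _ _ _    ≟-SType sel _         = no λ ()
  outS _ _ _    ≟-SType bra _         = no λ ()
  outS _ _ _    ≟-SType spec _        = no λ ()
  sel _         ≟-SType end           = no λ ()
  sel _         ≟-SType inV _ _       = no λ ()
  sel _         ≟-SType outV _ _      = no λ ()
  sel _         ≟-SType inS _ _ _     = no λ ()
  sel _         ≟-SType outS _ _ _    = no λ ()
  sel _         ≟-SType bra _         = no λ ()
  sel _         ≟-SType spec _        = no λ ()
  bra _         ≟-SType end           = no λ ()
  bra _         ≟-SType inV _ _       = no λ ()
  bra _         ≟-SType outV _ _      = no λ ()
  bra _         ≟-SType inS _ _ _     = no λ ()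
  bra _         ≟-SType outS _ _ _    = no λ ()
  bra _         ≟-SType sel _         = no λ ()
  bra _         ≟-SType spec _        = no λ ()
  spec _        ≟-SType end           = no λ ()
  spec _        ≟-SType inV _ _       = no λ ()
  spec _        ≟-SType outV _ _      = no λ ()
  spec _        ≟-SType inS _ _ _     = no λ ()
  spec _        ≟-SType outS _ _ _    = no λ ()
  spec _        ≟-SType sel _         = no λ ()
  spec _        ≟-SType bra _         = no λ ()

labelled? : ∀ {A : Set} {P : A → Set} (l : Label) {xs : List (Label × A)} →
  All (λ x → Dec (P (proj₂ x))) xs → Dec (∃[ a ] (l , a) ∈ xs × P a)
labelled? l []                         = no λ { (_ , () , _) }
labelled? l {(k , a) ∷ _} (Pa? ∷ Pas?) =
  map′ (λ { (inj₁ (refl , pa)) → a , here refl , pa ; (inj₂ (b , b∈ , pb)) → b , there b∈ , pb })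
       (λ { (_ , here refl , pa) → inj₁ (refl , pa) ; (b , there b∈ , pb) → inj₂ (b , b∈ , pb) })
       ((l ≟ k ×-dec Pa?) ⊎-dec labelled? l Pas?)

module _ {G : Set} where

  Branches : Set
  Branches = List (Label × SType G)

  _⊣[_]_ : Branches → Label → Branches → Set
  L ⊣[ l ] R = ∃[ S ] (l , S) ∈ L × ∃[ S' ] (l , S') ∈ R × S ⊣ S'

  -- The premise that rules (3) and (4) impose on each summand of the orchestrator.
  Summand : Branches → Branches → Label × Orch → Set
  Summand L R o = Σ (SType G) λ S → Σ (SType G) λ S' →
    ((proj₁ o , S) ∈ L) × ((proj₁ o , S') ∈ R) × (proj₂ o ∶ S ⊣ S')

  summand : ∀ {L R l} → L ⊣[ l ] R → Σ[ f ∈ Orch ] Summand L R (l , f)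
  summand (S , l∈L , S' , l∈R , f , d) = f , S , S' , l∈L , l∈R , d

  summands⇒⊣[] : ∀ {L R os l} → All (Summand L R) os → l ∈ map proj₁ os → L ⊣[ l ] R
  summands⇒⊣[] s l∈os with ∈-map⁻ proj₁ l∈os
  ... | (_ , f) , o∈os , refl with All.lookup s o∈os
  ... | S , S' , l∈L , l∈R , d = S , l∈L , S' , l∈R , f , d

  summands : ∀ {L R ls} → All (λ l → L ⊣[ l ] R) ls →
    Σ[ os ∈ List (Label × Orch) ] map proj₁ os ≡ ls × All (Summand L R) os
  summands []                   = [] , refl , []
  summands {ls = l ∷ _} (p ∷ ps) with summand p | summands ps
  ... | f , s | os , refl , ss  = (l , f) ∷ os , refl , s ∷ ss

  summands⁺ : ∀ {A : Set} {L R} (xs : List⁺ (Label × A)) → All (λ l → L ⊣[ l ] R) (labels xs) →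
    Σ[ os ∈ List⁺ (Label × Orch) ] labels os ≡ labels xs × All (Summand L R) (toList os)
  summands⁺ _ ps with summands ps
  ... | o ∷ os , eq , ss = o ∷ os , eq , ss

  ∈⇒label∈ : ∀ {A : Set} {xs : List (Label × A)} {ls} → map proj₁ xs ≡ ls →
    ∀ {l a} → (l , a) ∈ xs → l ∈ ls
  ∈⇒label∈ refl x∈xs = ∈-map⁺ proj₁ x∈xs

  labels⊆ : ∀ {A : Set} {xs : List (Label × A)} {ls} →
    (∀ {l a} → (l , a) ∈ xs → l ∈ ls) → ∀ {l} → l ∈ map proj₁ xs → l ∈ ls
  labels⊆ cov l∈xs with ∈-map⁻ proj₁ l∈xs
  ... | _ , x∈xs , refl = cov x∈xs

  sel-⊣-bra : ∀ {bs cs} → Unique (labels bs) →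
    All (λ l → toList bs ⊣[ l ] toList cs) (labels bs) ⇔ sel bs ⊣ bra cs
  sel-⊣-bra {bs} u = mk⇔
    (λ ps → let os , eq , ss = summands⁺ bs ps in
      Σₒ os , c-sel-bra os (subst Unique (sym eq) u) (∈⇒label∈ (sym eq)) ss)
    (λ { (_ , c-sel-bra os _ cov ss) → All.tabulate (summands⇒⊣[] ss ∘′ labels⊆ cov) })

  bra-⊣-sel : ∀ {cs bs} → Unique (labels bs) →
    All (λ l → toList cs ⊣[ l ] toList bs) (labels bs) ⇔ bra cs ⊣ sel bs
  bra-⊣-sel {bs = bs} u = mk⇔
    (λ ps → let os , eq , ss = summands⁺ bs ps in
      Σₒ os , c-bra-sel os (subst Unique (sym eq) u) (∈⇒label∈ (sym eq)) ss)
    (λ { (_ , c-bra-sel os _ cov ss) → All.tabulate (summands⇒⊣[] ss ∘′ labels⊆ cov) })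

  spec-⊣-bra : ∀ {is js} → Any (λ l → toList is ⊣[ l ] toList js) (labels is) ⇔ spec is ⊣ bra js
  spec-⊣-bra = mk⇔
    (λ p → let l , q = satisfied p ; f , s = summand q in
      pre l f , c-spec-bra ((l , f) ∷ []) ([] ∷ []) (s ∷ []))
    (λ { (_ , c-spec-bra (o ∷ _) _ ((S , S' , l∈L , l∈R , d) ∷ _)) →
           lose (∈-map⁺ proj₁ l∈L) (S , l∈L , S' , l∈R , proj₂ o , d) })

  bra-⊣-spec : ∀ {js is} → Any (λ l → toList js ⊣[ l ] toList is) (labels is) ⇔ bra js ⊣ spec is
  bra-⊣-spec = mk⇔
    (λ p → let l , q = satisfied p ; f , s = summand q in
      pre l f , c-bra-spec ((l , f) ∷ []) ([] ∷ []) (s ∷ []))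
    (λ { (_ , c-bra-spec (o ∷ _) _ ((S , S' , l∈L , l∈R , d) ∷ _)) →
           lose (∈-map⁺ proj₁ l∈R) (S , l∈L , S' , l∈R , proj₂ o , d) })

  inV-⊣-outV : ∀ {g h : G} {S S'} → (g ≡ h × S ⊣ S') ⇔ inV g S ⊣ outV h S'
  inV-⊣-outV = mk⇔ (λ { (refl , f , d) → • f , c-inV d }) (λ { (• f , c-inV d) → refl , f , d })

  outV-⊣-inV : ∀ {g h : G} {S S'} → (g ≡ h × S ⊣ S') ⇔ outV g S ⊣ inV h S'
  outV-⊣-inV = mk⇔ (λ { (refl , f , d) → • f , c-outV d }) (λ { (• f , c-outV d) → refl , f , d })

  inS-⊣-outS : ∀ {S₁ T₁ : SType G} {p q S₂ T₂} →
    (S₁ ≡ T₁ × p ≡ q × S₂ ⊣ T₂) ⇔ inS S₁ p S₂ ⊣ outS T₁ q T₂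
  inS-⊣-outS = mk⇔ (λ { (refl , refl , f , d) → • f , c-inS d })
                   (λ { (• f , c-inS d) → refl , refl , f , d })

  outS-⊣-inS : ∀ {S₁ T₁ : SType G} {p q S₂ T₂} →
    (S₁ ≡ T₁ × p ≡ q × S₂ ⊣ T₂) ⇔ outS S₁ p S₂ ⊣ inS T₁ q T₂
  outS-⊣-inS = mk⇔ (λ { (refl , refl , f , d) → • f , c-outS d })
                   (λ { (• f , c-outS d) → refl , refl , f , d })

module _ {G : Set} (_≟G_ : DecidableEquality G) where

  open STypeEquality _≟G_ using (_≟-SType_)

  Decider : SType G → Set
  Decider S = (S' : SType G) → WF S' → Dec (S ⊣ S')

  _⊣[_]?_ : ∀ {L R : Branches} → All (λ b → Decider (proj₂ b)) L → (l : Label) →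
    All (λ b → WF (proj₂ b)) R → Dec (L ⊣[ l ] R)
  ds ⊣[ l ]? ws = labelled? l (All.map (λ d → labelled? l (All.map (λ {b} → d (proj₂ b)) ws)) ds)

  -- The recursion is on the well-formedness proof of the left type; that of the
  -- right type supplies distinct labels when it is a selection.
  ⊣-dec    : ∀ {S : SType G} → WF S → Decider S
  deciders : ∀ {L : Branches} → All (λ b → WF (proj₂ b)) L → All (λ b → Decider (proj₂ b)) L

  deciders []       = []
  deciders (w ∷ ws) = ⊣-dec w ∷ deciders ws

  ⊣-dec wf-end S' _ = yes (𝟙 , c-end)
  ⊣-dec (wf-inV {g} w) (outV h S') (wf-outV w') =
    Dec.map inV-⊣-outV (g ≟G h ×-dec ⊣-dec w S' w')
  ⊣-dec (wf-outV {g} w) (inV h S') (wf-inV w') =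
    Dec.map outV-⊣-inV (g ≟G h ×-dec ⊣-dec w S' w')
  ⊣-dec (wf-inS {S₁} {p} _ w) (outS T₁ q S') (wf-outS _ w') =
    Dec.map inS-⊣-outS (S₁ ≟-SType T₁ ×-dec p ≟-Pol q ×-dec ⊣-dec w S' w')
  ⊣-dec (wf-outS {S₁} {p} _ w) (inS T₁ q S') (wf-inS _ w') =
    Dec.map outS-⊣-inS (S₁ ≟-SType T₁ ×-dec p ≟-Pol q ×-dec ⊣-dec w S' w')
  ⊣-dec (wf-sel {bs} u ws) (bra cs) (wf-bra _ ws') =
    Dec.map (sel-⊣-bra u) (all? (λ l → deciders ws ⊣[ l ]? ws') (labels bs))
  ⊣-dec (wf-bra _ ws) (sel bs) (wf-sel u ws') =
    Dec.map (bra-⊣-sel u) (all? (λ l → deciders ws ⊣[ l ]? ws') (labels bs))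
  ⊣-dec (wf-spec {is} _ ws) (bra js) (wf-bra _ ws') =
    Dec.map spec-⊣-bra (any? (λ l → deciders ws ⊣[ l ]? ws') (labels is))
  ⊣-dec (wf-bra _ ws) (spec is) (wf-spec _ ws') =
    Dec.map bra-⊣-spec (any? (λ l → deciders ws ⊣[ l ]? ws') (labels is))
  ⊣-dec (wf-inV _)     end          _ = no λ { (_ , ()) }
  ⊣-dec (wf-inV _)     (inV _ _)    _ = no λ { (_ , ()) }
  ⊣-dec (wf-inV _)     (inS _ _ _)  _ = no λ { (_ , ()) }
  ⊣-dec (wf-inV _)     (outS _ _ _) _ = no λ { (_ , ()) }
  ⊣-dec (wf-inV _)     (sel _)      _ = no λ { (_ , ()) }
  ⊣-dec (wf-inV _)     (bra _)      _ = no λ { (_ , ()) }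
  ⊣-dec (wf-inV _)     (spec _)     _ = no λ { (_ , ()) }
  ⊣-dec (wf-outV _)    end          _ = no λ { (_ , ()) }
  ⊣-dec (wf-outV _)    (outV _ _)   _ = no λ { (_ , ()) }
  ⊣-dec (wf-outV _)    (inS _ _ _)  _ = no λ { (_ , ()) }
  ⊣-dec (wf-outV _)    (outS _ _ _) _ = no λ { (_ , ()) }
  ⊣-dec (wf-outV _)    (sel _)      _ = no λ { (_ , ()) }
  ⊣-dec (wf-outV _)    (bra _)      _ = no λ { (_ , ()) }
  ⊣-dec (wf-outV _)    (spec _)     _ = no λ { (_ , ()) }
  ⊣-dec (wf-inS _ _)   end          _ = no λ { (_ , ()) }
  ⊣-dec (wf-inS _ _)   (inV _ _)    _ = no λ { (_ , ()) }
  ⊣-dec (wf-inS _ _)   (outV _ _)   _ = no λ { (_ , ()) }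
  ⊣-dec (wf-inS _ _)   (inS _ _ _)  _ = no λ { (_ , ()) }
  ⊣-dec (wf-inS _ _)   (sel _)      _ = no λ { (_ , ()) }
  ⊣-dec (wf-inS _ _)   (bra _)      _ = no λ { (_ , ()) }
  ⊣-dec (wf-inS _ _)   (spec _)     _ = no λ { (_ , ()) }
  ⊣-dec (wf-outS _ _)  end          _ = no λ { (_ , ()) }
  ⊣-dec (wf-outS _ _)  (inV _ _)    _ = no λ { (_ , ()) }
  ⊣-dec (wf-outS _ _)  (outV _ _)   _ = no λ { (_ , ()) }
  ⊣-dec (wf-outS _ _)  (outS _ _ _) _ = no λ { (_ , ()) }
  ⊣-dec (wf-outS _ _)  (sel _)      _ = no λ { (_ , ()) }
  ⊣-dec (wf-outS _ _)  (bra _)      _ = no λ { (_ , ()) }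
  ⊣-dec (wf-outS _ _)  (spec _)     _ = no λ { (_ , ()) }
  ⊣-dec (wf-sel _ _)   end          _ = no λ { (_ , ()) }
  ⊣-dec (wf-sel _ _)   (inV _ _)    _ = no λ { (_ , ()) }
  ⊣-dec (wf-sel _ _)   (outV _ _)   _ = no λ { (_ , ()) }
  ⊣-dec (wf-sel _ _)   (inS _ _ _)  _ = no λ { (_ , ()) }
  ⊣-dec (wf-sel _ _)   (outS _ _ _) _ = no λ { (_ , ()) }
  ⊣-dec (wf-sel _ _)   (sel _)      _ = no λ { (_ , ()) }
  ⊣-dec (wf-sel _ _)   (spec _)     _ = no λ { (_ , ()) }
  ⊣-dec (wf-bra _ _)   end          _ = no λ { (_ , ()) }
  ⊣-dec (wf-bra _ _)   (inV _ _)    _ = no λ { (_ , ()) }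
  ⊣-dec (wf-bra _ _)   (outV _ _)   _ = no λ { (_ , ()) }
  ⊣-dec (wf-bra _ _)   (inS _ _ _)  _ = no λ { (_ , ()) }
  ⊣-dec (wf-bra _ _)   (outS _ _ _) _ = no λ { (_ , ()) }
  ⊣-dec (wf-bra _ _)   (bra _)      _ = no λ { (_ , ()) }
  ⊣-dec (wf-spec _ _)  end          _ = no λ { (_ , ()) }
  ⊣-dec (wf-spec _ _)  (inV _ _)    _ = no λ { (_ , ()) }
  ⊣-dec (wf-spec _ _)  (outV _ _)   _ = no λ { (_ , ()) }
  ⊣-dec (wf-spec _ _)  (inS _ _ _)  _ = no λ { (_ , ()) }
  ⊣-dec (wf-spec _ _)  (outS _ _ _) _ = no λ { (_ , ()) }
  ⊣-dec (wf-spec _ _)  (sel _)      _ = no λ { (_ , ()) }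
  ⊣-dec (wf-spec _ _)  (spec _)     _ = no λ { (_ , ()) }

proposition1 : {G : Set} → DecidableEquality G →
    (S S' : SType G) → WF S → WF S' → Dec (S ⊣ S')
proposition1 _≟G_ _ S' w w' = ⊣-dec _≟G_ w S' w'
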